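{- Let $G_1=(V_1,E_1)$ and $G_2=(V_2,E_2)$ be graphs and $G=G_1+G_2$. Let $\mathcal{A}=\{A_1,\ldots,A_k\}$ be the partition of $V_1$ and $\mathcal{B}=\{B_1,\ldots,B_{k'}\}$ the partition of $V_2$ obtained by the procedure described in the context. If $f$ is an automorphism of $G$, then $f$ permutes the set $\mathcal{A}\cup\mathcal{B}$, i.e. for every $C\in\mathcal{A}\cup\mathcal{B}$ the image $f(C)$ is again a member of $\mathcal{A}\cup\mathcal{B}$.
   Context: All graphs are finite and simple. The join $G_1+G_2$ of graphs on disjoint vertex sets $V_1,V_2$ has vertex set $V_1\cup V_2$ and edge set $E_1\cup E_2\cup\{uv:u\in V_1,v\in V_2\}$. For a vertex $v$ of $G$, $N_G(v)$ is the set of neighbours of $v$ and $\overline{N_G(v)}=V(G)\setminus N_G(v)$ (so $v\in\overline{N_G(v)}$; for $v\in V_1$ one has $\overline{N_G(v)}\subseteq V_1$, and likewise for $V_2$). Partition of $V_1$: choose $v_1\in V_1$ and set $A:=\overline{N_G(v_1)}$; as long as there is a vertex $v$ of $G$ with $\overline{N_G(v)}\cap A\neq\emptyset$ and $\overline{N_G(v)}\not\subseteq A$, replace $A$ by $A\cup\overline{N_G(v)}$; when no such vertex exists, let $A_1:=A$. Then choose a vertex of $V_1$ not in $A_1$ and repeat the procedure to obtain $A_2$, and so on, until $V_1$ is partitioned into $A_1,\ldots,A_k$. The same procedure applied starting from vertices of $V_2$ partitions $V_2$ into $B_1,\ldots,B_{k'}$. -}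

module Defs where

open import Level using (0ℓ)
open import Data.Nat using (ℕ)
open import Data.Fin using (Fin)
open import Data.Sum using (_⊎_; inj₁; inj₂)
open import Data.Unit using (⊤)
open import Data.Product using (_×_; ∃)
open import Relation.Nullary using (¬_)
open import Relation.Binary.PropositionalEquality using (_≡_)
open import Function.Bundles using (_↔_; Inverse)

record Graph (V : Set) : Set₁ where
  field
    Adj   : V → V → Set
    sym   : ∀ {u v} → Adj u v → Adj v u
    irref : ∀ {v} → ¬ Adj v v

open Graph public

FinGraph : ℕ → Set₁
FinGraph n = Graph (Fin n)

JoinAdj : ∀ {V₁ V₂ : Set} → Graph V₁ → Graph V₂ → V₁ ⊎ V₂ → V₁ ⊎ V₂ → Set
JoinAdj G₁ G₂ (inj₁ a) (inj₁ b) = Adj G₁ a b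
JoinAdj G₁ G₂ (inj₂ a) (inj₂ b) = Adj G₂ a b
JoinAdj G₁ G₂ (inj₁ a) (inj₂ b) = ⊤
JoinAdj G₁ G₂ (inj₂ a) (inj₁ b) = ⊤

joinSym : ∀ {V₁ V₂ : Set} (G₁ : Graph V₁) (G₂ : Graph V₂) {u v : V₁ ⊎ V₂} →
          JoinAdj G₁ G₂ u v → JoinAdj G₁ G₂ v u
joinSym G₁ G₂ {inj₁ a} {inj₁ b} p = sym G₁ p
joinSym G₁ G₂ {inj₂ a} {inj₂ b} p = sym G₂ p
joinSym G₁ G₂ {inj₁ a} {inj₂ b} p = _
joinSym G₁ G₂ {inj₂ a} {inj₁ b} p = _

joinIrref : ∀ {V₁ V₂ : Set} (G₁ : Graph V₁) (G₂ : Graph V₂) {v : V₁ ⊎ V₂} →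
            ¬ JoinAdj G₁ G₂ v v
joinIrref G₁ G₂ {inj₁ a} = irref G₁
joinIrref G₁ G₂ {inj₂ a} = irref G₂

_+ᴳ_ : ∀ {V₁ V₂ : Set} → Graph V₁ → Graph V₂ → Graph (V₁ ⊎ V₂)
G₁ +ᴳ G₂ = record { Adj = JoinAdj G₁ G₂ ; sym = λ {u} {v} → joinSym G₁ G₂ {u} {v} ; irref = λ {v} → joinIrref G₁ G₂ {v} }

Subset : Set → Set₁
Subset V = V → Set

NonNbr : ∀ {V} → Graph V → V → Subset V
NonNbr G v u = ¬ Adj G v u

-- The set produced by the procedure started at v₁: start with A := N̄(v₁) and
-- add N̄(v) whenever N̄(v) meets A.  Its output is exactly the least set
-- containing N̄(v₁) that is closed under this step, given inductively here.
data Block {V : Set} (G : Graph V) (v₁ : V) : Subset V where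
  start : ∀ {u} → NonNbr G v₁ u → Block G v₁ u
  grow  : ∀ {v w u} → Block G v₁ w → NonNbr G v w → NonNbr G v u → Block G v₁ u

-- Membership in 𝒜 ∪ ℬ: C is one of the blocks, i.e. C = Block G v (as sets)
-- for some vertex v of G (v ∈ V₁ gives the Aᵢ, v ∈ V₂ gives the Bⱼ).
SameSet : ∀ {V} → Subset V → Subset V → Set
SameSet C D = ∀ u → (C u → D u) × (D u → C u)

IsBlock : ∀ {V} → Graph V → Subset V → Set
IsBlock G C = ∃ λ v → SameSet C (Block G v)

IsAutomorphism : ∀ {V} → Graph V → (V ↔ V) → Set
IsAutomorphism G f = ∀ u v →
  (Adj G u v → Adj G (Inverse.to f u) (Inverse.to f v)) ×
  (Adj G (Inverse.to f u) (Inverse.to f v) → Adj G u v)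

Image : ∀ {V} → (V ↔ V) → Subset V → Subset V
Image f C u = ∃ λ u' → C u' × Inverse.to f u' ≡ u

-- An automorphism f preserves non-adjacency, so it carries every step of the
-- procedure started at v to a step of the procedure started at f v; hence
-- f(Block v) ⊆ Block (f v), and the same argument for f⁻¹ gives equality.
-- Nothing about the join is used: the blocks of any graph are permuted.
module Submission where

open import Defs
open import Data.Nat using (ℕ)
open import Data.Fin using (Fin)
open import Data.Sum using (_⊎_)
open import Data.Product using (_,_; proj₁; proj₂)
open import Function.Bundles using (_↔_; Inverse)
open import Function.Construct.Symmetry using (↔-sym)
open import Relation.Binary.PropositionalEquality using (refl; subst; subst₂) renaming (sym to ≡-sym)

module Automorphism {V : Set} (G : Graph V) (f : V ↔ V) (f-aut : IsAutomorphism G f) where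

  open Inverse f using (to; from; strictlyInverseˡ)

  IsAutomorphism-sym : IsAutomorphism G (↔-sym f)
  IsAutomorphism-sym u v =
      (λ a → proj₂ (f-aut (from u) (from v)) (section a))
    , (λ a → retract (proj₁ (f-aut (from u) (from v)) a))
    where
    section : ∀ {x y} → Adj G x y → Adj G (to (from x)) (to (from y))
    section = subst₂ (Adj G) (≡-sym (strictlyInverseˡ _)) (≡-sym (strictlyInverseˡ _))

    retract : ∀ {x y} → Adj G (to (from x)) (to (from y)) → Adj G x y
    retract = subst₂ (Adj G) (strictlyInverseˡ _) (strictlyInverseˡ _)

  NonNbr-map : ∀ {v u} → NonNbr G v u → NonNbr G (to v) (to u)
  NonNbr-map {v} {u} v≁u a = v≁u (proj₂ (f-aut v u) a)

  Block-map : ∀ {v u} → Block G v u → Block G (to v) (to u)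
  Block-map (start v₁≁u)     = start (NonNbr-map v₁≁u)
  Block-map (grow b v≁w v≁u) = grow (Block-map b) (NonNbr-map v≁w) (NonNbr-map v≁u)

module BlockImage {V : Set} (G : Graph V) (f : V ↔ V) (f-aut : IsAutomorphism G f) where

  open Inverse f using (to; from; strictlyInverseˡ; strictlyInverseʳ)
  open Automorphism G f f-aut using (IsAutomorphism-sym; Block-map)
  open Automorphism G (↔-sym f) IsAutomorphism-sym using () renaming (Block-map to Block-map⁻¹)

  Block-unmap : ∀ {v u} → Block G (to v) u → Block G v (from u)
  Block-unmap {v} b =
    subst (λ x → Block G x _) (strictlyInverseʳ v) (Block-map⁻¹ b)

  Image-Block : ∀ {C v} → SameSet C (Block G v) → SameSet (Image f C) (Block G (to v))
  Image-Block C≈Bv u =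
      (λ { (u' , u'∈C , refl) → Block-map (proj₁ (C≈Bv u') u'∈C) })
    , (λ u∈B → from u , proj₂ (C≈Bv (from u)) (Block-unmap u∈B) , strictlyInverseˡ u)

  IsBlock-Image : ∀ {C} → IsBlock G C → IsBlock G (Image f C)
  IsBlock-Image (v , C≈Bv) = to v , Image-Block C≈Bv

lemma2p2 : (n₁ n₂ : ℕ) (G₁ : FinGraph n₁) (G₂ : FinGraph n₂)
    (f : (Fin n₁ ⊎ Fin n₂) ↔ (Fin n₁ ⊎ Fin n₂)) →
    IsAutomorphism (G₁ +ᴳ G₂) f →
    (C : Subset (Fin n₁ ⊎ Fin n₂)) → IsBlock (G₁ +ᴳ G₂) C →
    IsBlock (G₁ +ᴳ G₂) (Image f C)
lemma2p2 n₁ n₂ G₁ G₂ f f-aut C = BlockImage.IsBlock-Image (G₁ +ᴳ G₂) f f-aut
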